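{- Let $i\ge 2$. The LZ-factorization of $P_i^{(\mathtt{a},\mathtt{b})}$ has exactly $2i-2$ phrases; for each $j$ with $1\le j\le 2i-3$ its $j$-th phrase is $(F_j^{(\mathtt{b},\mathtt{a})})^R$, and its last, $(2i-2)$-th, phrase is $\mathtt{b}$.
   Context: For distinct symbols $a,b$: $F_1^{(a,b)}=b$, $F_2^{(a,b)}=a$, $F_i^{(a,b)}=F_{i-1}^{(a,b)}F_{i-2}^{(a,b)}$ for $i\ge 3$. $\pi^{(a,b)}$ is the morphism with $a\mapsto ab$, $b\mapsto abb$, and $P_i^{(a,b)}=(\pi^{(a,b)})^{i-1}(a)$. $x^R$ denotes the reversal of $x$. The LZ-factorization of $w$ is the factorization $w=s_1\cdots s_m$ into non-empty phrases where each $s_i$ is either a single symbol occurring for the first time in $s_1\cdots s_i$, or the longest prefix of $s_i\cdots s_m$ occurring as a substring of $s_1\cdots s_{i-1}$. -}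

module Defs where

open import Data.Nat using (ℕ; zero; suc; _≤_; _∸_; _*_)
open import Data.List using (List; []; _∷_; _++_; [_]; reverse; length; concatMap; map; upTo)
open import Data.Product using (∃; ∃₂; _×_)
open import Relation.Binary.PropositionalEquality using (_≡_)
open import Data.List.Membership.Propositional using (_∉_)

data Sym : Set where
  a b : Sym

Word : Set
Word = List Sym

-- F_i^{(x,y)}: F 1 = y, F 2 = x, F i = F (i-1) F (i-2) for i ≥ 3;
-- index 0 is not used by the paper (set to the empty word)
F : Sym → Sym → ℕ → Word
F x y zero = []
F x y (suc zero) = [ y ]
F x y (suc (suc zero)) = [ x ]
F x y (suc (suc (suc i))) = F x y (suc (suc i)) ++ F x y (suc i)

πab-sym : Sym → Word
πab-sym a = a ∷ b ∷ []
πab-sym b = a ∷ b ∷ b ∷ []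

πab : Word → Word
πab = concatMap πab-sym

iter : ℕ → (Word → Word) → Word → Word
iter zero f w = w
iter (suc n) f w = f (iter n f w)

P : ℕ → Word
P i = iter (i ∸ 1) πab [ a ]

_⊑_ : Word → Word → Set
u ⊑ w = ∃₂ λ x y → x ++ u ++ y ≡ w

_≼_ : Word → Word → Set
u ≼ w = ∃ λ t → u ++ t ≡ w

-- LZFrom p r ps : ps is the LZ-factorization of the remaining suffix r,
-- given that the already-factorized prefix is p.
data LZFrom : Word → Word → List Word → Set where
  lz-done : ∀ {p} → LZFrom p [] []
  lz-new  : ∀ {p r ps} (x : Sym) → x ∉ p →
            LZFrom (p ++ [ x ]) r ps →
            LZFrom p (x ∷ r) ([ x ] ∷ ps)
  lz-copy : ∀ {p r ps} (s : Word) → 1 ≤ length s → s ⊑ p →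
            (∀ t → t ≼ (s ++ r) → t ⊑ p → length t ≤ length s) →
            LZFrom (p ++ s) r ps →
            LZFrom p (s ++ r) (s ∷ ps)

IsLZ : Word → List Word → Set
IsLZ w ps = LZFrom [] w ps

-- Write Gⱼ for the reversal of F_j^{(b,a)}, so that G₁ = a, G₂ = b, Gⱼ₊₂ = Gⱼ Gⱼ₊₁, and put
-- Hₙ = G₁ ⋯ Gₙ. The morphism σ : a ↦ b, b ↦ ab shifts this sequence, σ(Gⱼ) = Gⱼ₊₁, hence
-- Hₙ₊₁ = a σ(Hₙ); together with π(w) ab = σ(b σ(w)) this gives P_i = H_{2i-3} b.
-- Greedy copying along G₁, …, G_{2i-3}, b is the LZ-factorization: Gⱼ (j ≥ 3) is a suffix of
-- H_{j-1}, but Gⱼ followed by the next letter (b for odd j, a for even j) is not a factor of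
-- H_{j-1}. An occurrence of it inside σ(H_{j-2}) desubstitutes to an occurrence of G_{j-1}
-- followed by its next letter in H_{j-2}, or, for even j, to one of bbb, which never occurs.
-- Finally, an LZ-factorization is unique, since every phrase is determined by the suffix it starts.
module Submission where

open import Defs
open import Data.Nat using (ℕ; zero; suc; _+_; _*_; _∸_; _≤_; z≤n; s≤s; _≤?_)
open import Data.Nat.Properties using (+-suc; +-comm; +-identityʳ; ≤-trans; ≤-reflexive; ≰⇒>)
open import Data.List
  using (List; []; _∷_; _++_; [_]; length; concat; concatMap; map; reverse; upTo; applyUpTo)
open import Data.List.Properties
  using (∷-injective; ∷-injectiveˡ; ∷-injectiveʳ; ++-assoc; ++-identityʳ; ++-identityʳ-unique;
         ++-conicalˡ; ++-cancelˡ; length-++; length-++-≤ˡ; length-++-≤ʳ; concatMap-++;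
         reverse-++; map-applyUpTo)
open import Data.List.Membership.Propositional using (_∈_)
open import Data.List.Membership.Propositional.Properties using (∈-++⁺ʳ)
open import Data.List.Relation.Unary.Any using (here)
open import Data.Product using (∃; ∃₂; _×_; _,_; map₁; map₂)
import Data.Product as Product
open import Data.Sum using (_⊎_; inj₁; inj₂)
open import Data.Empty using (⊥-elim)
open import Function using (id; _∘_)
open import Relation.Nullary using (¬_; yes; no)
open import Relation.Binary.PropositionalEquality
  using (_≡_; refl; sym; trans; cong; cong₂; subst; subst₂; module ≡-Reasoning)

open ≡-Reasoning

≼⇒⊑ : ∀ {u w} → u ≼ w → u ⊑ w
≼⇒⊑ (t , eq) = [] , t , eq

≼-++ : ∀ {u v} w → u ≼ v → u ≼ (v ++ w)
≼-++ {u} w (t , refl) = t ++ w , sym (++-assoc u t w)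

≼-trans : ∀ {u v w} → u ≼ v → v ≼ w → u ≼ w
≼-trans {u} (t , refl) (t' , refl) = t ++ t' , sym (++-assoc u t t')

≼-antisym : ∀ {u v} → u ≼ v → v ≼ u → u ≡ v
≼-antisym {u} (t , refl) (t' , eq) =
  trans (sym (++-identityʳ u)) (cong (u ++_) (sym t≡[]))
  where
  t≡[] : t ≡ []
  t≡[] = ++-conicalˡ t t' (++-identityʳ-unique u (trans (sym eq) (++-assoc u t t')))

≼-ordered : ∀ {u v w} → u ≼ w → v ≼ w → length u ≤ length v → u ≼ v
≼-ordered {[]} {v} _ _ _ = v , refl
≼-ordered {_ ∷ _} {[]} _ _ ()
≼-ordered {_ ∷ _} {_ ∷ _} {[]} (_ , ()) _ _
≼-ordered {x ∷ u} {_ ∷ v} {_ ∷ w} (t , eq) (t' , eq') (s≤s le)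
  with refl ← ∷-injectiveˡ eq | refl ← ∷-injectiveˡ eq' =
  map₂ (cong (x ∷_)) (≼-ordered (t , ∷-injectiveʳ eq) (t' , ∷-injectiveʳ eq') le)

⊑-trans : ∀ {u v w} → u ⊑ v → v ⊑ w → u ⊑ w
⊑-trans {u} (x , y , refl) (x' , y' , refl) = x' ++ x , y ++ y' , (begin
  (x' ++ x) ++ u ++ y ++ y'    ≡⟨ ++-assoc x' x _ ⟩
  x' ++ x ++ u ++ y ++ y'      ≡⟨ cong (λ v → x' ++ x ++ v) (sym (++-assoc u y y')) ⟩
  x' ++ x ++ (u ++ y) ++ y'    ≡⟨ cong (x' ++_) (sym (++-assoc x (u ++ y) y')) ⟩
  x' ++ (x ++ u ++ y) ++ y'    ∎)

⊑-length : ∀ {u w} → u ⊑ w → length u ≤ length w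
⊑-length {u} (x , y , refl) = ≤-trans (length-++-≤ˡ u) (length-++-≤ʳ (u ++ y) {x})

⊑-∷ : ∀ {u w x v} → w ≡ x ∷ v → u ⊑ w → u ≼ w ⊎ u ⊑ v
⊑-∷ refl ([] , y , eq) = inj₁ (y , eq)
⊑-∷ refl (_ ∷ x , y , eq) = inj₂ (x , y , ∷-injectiveʳ eq)

∷-⊑⇒∈ : ∀ {x s p} → (x ∷ s) ⊑ p → x ∈ p
∷-⊑⇒∈ {x} (u , v , refl) = ∈-++⁺ʳ u (here refl)

longest-factor-prefix : ∀ {p g d rest} → [ d ] ≼ rest → ¬ (g ++ [ d ]) ⊑ p →
                        ∀ t → t ≼ (g ++ rest) → t ⊑ p → length t ≤ length g
longest-factor-prefix {p} {g} {d} (r , refl) gd⋢p t t≼ t⊑p with length t ≤? length g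
... | yes t≤g = t≤g
... | no t≰g = ⊥-elim (gd⋢p (⊑-trans (≼⇒⊑ gd≼t) t⊑p))
  where
  gd≼t : (g ++ [ d ]) ≼ t
  gd≼t = ≼-ordered (r , ++-assoc g [ d ] r) t≼
           (≤-trans (≤-reflexive (trans (length-++ g) (+-comm (length g) 1))) (≰⇒> t≰g))

nonempty-++ : ∀ s {r : Word} → 1 ≤ length s → ¬ s ++ r ≡ []
nonempty-++ (_ ∷ _) _ ()

private
  LZFrom-unique′ : ∀ {p w w' ps qs} → LZFrom p w ps → LZFrom p w' qs → w ≡ w' → ps ≡ qs
  LZFrom-unique′ lz-done lz-done _ = refl
  LZFrom-unique′ lz-done (lz-new _ _ _) ()
  LZFrom-unique′ lz-done (lz-copy s 1≤s _ _ _) eq = ⊥-elim (nonempty-++ s 1≤s (sym eq))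
  LZFrom-unique′ (lz-new _ _ _) lz-done ()
  LZFrom-unique′ (lz-copy s 1≤s _ _ _) lz-done eq = ⊥-elim (nonempty-++ s 1≤s eq)
  LZFrom-unique′ (lz-new x _ d) (lz-new _ _ d') eq with refl , eq' ← ∷-injective eq =
    cong ([ x ] ∷_) (LZFrom-unique′ d d' eq')
  LZFrom-unique′ (lz-new x x∉p _) (lz-copy (_ ∷ _) _ s⊑p _ _) eq
    with refl ← ∷-injectiveˡ eq = ⊥-elim (x∉p (∷-⊑⇒∈ s⊑p))
  LZFrom-unique′ (lz-copy (_ ∷ _) _ s⊑p _ _) (lz-new x x∉p _) eq
    with refl ← ∷-injectiveˡ eq = ⊥-elim (x∉p (∷-⊑⇒∈ s⊑p))
  LZFrom-unique′ (lz-copy {r = r} s _ s⊑p s-max d) (lz-copy {r = r'} s' _ s'⊑p s'-max d') eq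
    with refl ← ≼-antisym (≼-ordered (r , eq) (r' , refl) (s'-max s (r , eq) s⊑p))
                          (≼-ordered (r' , refl) (r , eq) (s-max s' (r' , sym eq) s'⊑p)) =
    cong (s ∷_) (LZFrom-unique′ d d' (++-cancelˡ s r r' eq))

LZFrom-unique : ∀ {p w ps qs} → LZFrom p w ps → LZFrom p w qs → ps ≡ qs
LZFrom-unique d d' = LZFrom-unique′ d d' refl

σ-letter : Sym → Word
σ-letter a = [ b ]
σ-letter b = a ∷ b ∷ []

σ : Word → Word
σ = concatMap σ-letter

σ-++ : ∀ u v → σ (u ++ v) ≡ σ u ++ σ v
σ-++ = concatMap-++ σ-letter

σ-head-a : ∀ w {r} → a ∷ r ≡ σ w → ∃ λ v → w ≡ b ∷ v × r ≡ b ∷ σ v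
σ-head-a (b ∷ v) refl = v , refl , refl

σ-head-b : ∀ w {r} → b ∷ r ≡ σ w → ∃ λ v → w ≡ a ∷ v × r ≡ σ v
σ-head-b (a ∷ v) refl = v , refl , refl

σ-prefix : ∀ u {w y} → σ u ++ y ≡ σ w → ∃ λ v → w ≡ u ++ v × y ≡ σ v
σ-prefix [] eq = _ , refl , eq
σ-prefix (a ∷ u) {a ∷ w} eq = map₂ (map₁ (cong (a ∷_))) (σ-prefix u (∷-injectiveʳ eq))
σ-prefix (b ∷ u) {b ∷ w} eq =
  map₂ (map₁ (cong (b ∷_))) (σ-prefix u (∷-injectiveʳ (∷-injectiveʳ eq)))

σ-suffix : ∀ w x {z} → x ++ z ≡ σ w →
           ∃₂ λ w₁ w₂ → w ≡ w₁ ++ w₂ × (z ≡ σ w₂ ⊎ a ∷ z ≡ σ w₂)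
σ-suffix w [] eq = [] , w , refl , inj₁ eq
σ-suffix (a ∷ w) (_ ∷ x) eq = Product.map (a ∷_) (map₂ (map₁ (cong (a ∷_))))
  (σ-suffix w x (∷-injectiveʳ eq))
σ-suffix (b ∷ w) (_ ∷ []) eq = [] , b ∷ w , refl , inj₂ (cong (a ∷_) (∷-injectiveʳ eq))
σ-suffix (b ∷ w) (_ ∷ _ ∷ x) eq = Product.map (b ∷_) (map₂ (map₁ (cong (b ∷_))))
  (σ-suffix w x (∷-injectiveʳ (∷-injectiveʳ eq)))

aa⋢σ : ∀ w → ¬ (a ∷ a ∷ []) ⊑ σ w
aa⋢σ w (x , _ , eq) with σ-suffix w x eq
... | _ , w₂ , _ , inj₁ e with σ-head-a w₂ e
...   | _ , _ , ()
aa⋢σ w (x , _ , eq) | _ , w₂ , _ , inj₂ e with σ-head-a w₂ e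
...   | _ , _ , ()

bbb⊑σ⇒aa⊑ : ∀ w → (b ∷ b ∷ b ∷ []) ⊑ σ w → (a ∷ a ∷ []) ⊑ w
bbb⊑σ⇒aa⊑ w (x , _ , eq) with σ-suffix w x eq
... | w₁ , w₂ , refl , inj₁ e with σ-head-b w₂ e
...   | w₃ , refl , e₃ with σ-head-b w₃ e₃
...     | w₄ , refl , _ = w₁ , w₄ , refl
bbb⊑σ⇒aa⊑ w (x , _ , eq) | w₁ , w₂ , refl , inj₂ e with σ-head-a w₂ e
...   | w₃ , refl , e₃ with σ-head-b w₃ (∷-injectiveʳ e₃)
...     | w₄ , refl , e₄ with σ-head-b w₄ e₄
...       | w₅ , refl , _ = w₁ ++ [ b ] , w₅ , ++-assoc w₁ [ b ] (a ∷ a ∷ w₅)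

σ-reflects-⊑ : ∀ {u} w → [ b ] ≼ u → σ u ⊑ σ w → u ⊑ w
σ-reflects-⊑ {u} w (_ , refl) (x , _ , eq) with σ-suffix w x eq
... | w₁ , w₂ , refl , inj₁ e with σ-prefix u {w₂} e
...   | v , refl , _ = w₁ , v , refl
σ-reflects-⊑ w (_ , refl) (x , _ , eq) | _ , w₂ , refl , inj₂ e with σ-head-a w₂ e
...   | _ , _ , ()

σ-prefix-a : ∀ t {w y} → σ t ++ a ∷ y ≡ σ w → (t ++ [ b ]) ≼ w
σ-prefix-a t {w} eq with σ-prefix t {w} eq
... | v , refl , e with σ-head-a v e
...   | v' , refl , _ = v' , ++-assoc t [ b ] v'

σ-desubst-tail : ∀ t w → (σ (a ∷ t) ++ [ a ]) ⊑ σ w → ∃ λ x → (x ∷ t ++ [ b ]) ⊑ w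
σ-desubst-tail t w (x , y , eq) with σ-suffix w x eq
... | w₁ , w₂ , refl , inj₁ e with σ-head-b w₂ e
...   | w₃ , refl , e₃ with σ-prefix-a t {w₃} (trans (sym (++-assoc (σ t) [ a ] y)) e₃)
...     | v , refl = a , w₁ , v , refl
σ-desubst-tail t w (x , y , eq) | w₁ , w₂ , refl , inj₂ e with σ-head-a w₂ e
...   | w₃ , refl , e₃
        with σ-prefix-a t {w₃} (trans (sym (++-assoc (σ t) [ a ] y)) (∷-injectiveʳ e₃))
...     | v , refl = b , w₁ , v , refl

G : ℕ → Word
G zero = []
G (suc zero) = [ a ]
G (suc (suc zero)) = [ b ]
G (suc (suc (suc j))) = G (suc j) ++ G (suc (suc j))

H : ℕ → Word
H zero = []
H (suc n) = H n ++ G (suc n)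

-- Unlike 2 * n, double (suc n) reduces to suc (suc (double n)), so G (3 + double m) unfolds.
double : ℕ → ℕ
double zero = zero
double (suc n) = suc (suc (double n))

reverse-F≡G : ∀ j → reverse (F b a j) ≡ G j
reverse-F≡G zero = refl
reverse-F≡G (suc zero) = refl
reverse-F≡G (suc (suc zero)) = refl
reverse-F≡G (suc (suc (suc j))) = trans (reverse-++ (F b a (suc (suc j))) (F b a (suc j)))
  (cong₂ _++_ (reverse-F≡G (suc j)) (reverse-F≡G (suc (suc j))))

σ-G : ∀ j → σ (G (suc j)) ≡ G (suc (suc j))
σ-G zero = refl
σ-G (suc zero) = refl
σ-G (suc (suc j)) = trans (σ-++ (G (suc j)) (G (suc (suc j)))) (cong₂ _++_ (σ-G j) (σ-G (suc j)))

H-σ : ∀ n → H (suc n) ≡ a ∷ σ (H n)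
H-σ zero = refl
H-σ (suc n) = begin
  H (suc n) ++ G (2 + n)            ≡⟨ cong₂ _++_ (H-σ n) (sym (σ-G n)) ⟩
  a ∷ σ (H n) ++ σ (G (suc n))      ≡⟨ cong (a ∷_) (sym (σ-++ (H n) (G (suc n)))) ⟩
  a ∷ σ (H (suc n))                 ∎

H-σ² : ∀ n → H (2 + n) ≡ σ (b ∷ σ (H n))
H-σ² n = trans (H-σ (suc n)) (cong (λ w → a ∷ σ w) (H-σ n))

G-nonempty : ∀ j → 1 ≤ length (G (suc j))
G-nonempty zero = s≤s z≤n
G-nonempty (suc zero) = s≤s z≤n
G-nonempty (suc (suc j)) = ≤-trans (G-nonempty j) (length-++-≤ˡ (G (suc j)))

G-odd-head : ∀ m → [ a ] ≼ G (3 + double m)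
G-odd-head zero = [ b ] , refl
G-odd-head (suc m) = ≼-++ (G (4 + double m)) (G-odd-head m)

G-even-head : ∀ m → [ b ] ≼ G (4 + double m)
G-even-head zero = a ∷ b ∷ [] , refl
G-even-head (suc m) = ≼-++ (G (5 + double m)) (G-even-head m)

G-abb : ∀ m → (a ∷ b ∷ b ∷ []) ≼ G (5 + double m)
G-abb zero = a ∷ b ∷ [] , refl
G-abb (suc m) = ≼-++ (G (6 + double m)) (G-abb m)

G-odd-b-abb : ∀ m → (a ∷ b ∷ b ∷ []) ≼ (G (3 + double m) ++ [ b ])
G-odd-b-abb zero = [] , refl
G-odd-b-abb (suc m) = ≼-++ [ b ] (G-abb m)

H-aba : ∀ k → (a ∷ b ∷ a ∷ []) ≼ H (3 + k)
H-aba zero = [ b ] , refl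
H-aba (suc k) = ≼-++ (G (4 + k)) (H-aba k)

G-⊑-H : ∀ s → G (3 + s) ⊑ H (2 + s)
G-⊑-H s = H s , [] , (begin
  H s ++ (G (suc s) ++ G (2 + s)) ++ []  ≡⟨ cong (H s ++_) (++-identityʳ _) ⟩
  H s ++ G (suc s) ++ G (2 + s)          ≡⟨ ++-assoc (H s) (G (suc s)) (G (2 + s)) ⟨
  H (2 + s)                               ∎)

b-⊑-H : ∀ n → [ b ] ⊑ H (2 + n)
b-⊑-H n = [ a ] , σ (σ (H n)) , sym (H-σ² n)

bbb⋢H : ∀ n → ¬ (b ∷ b ∷ b ∷ []) ⊑ H (2 + n)
bbb⋢H n occ
  with ⊑-∷ refl (bbb⊑σ⇒aa⊑ (b ∷ σ (H n)) (subst ((b ∷ b ∷ b ∷ []) ⊑_) (H-σ² n) occ))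
... | inj₁ (_ , ())
... | inj₂ aa⊑σHn = aa⋢σ (H n) aa⊑σHn

G-even≡σ : ∀ m {t} → a ∷ t ≡ G (3 + double m) → G (4 + double m) ≡ σ (a ∷ t)
G-even≡σ m at≡G = trans (sym (σ-G (2 + double m))) (cong σ (sym at≡G))

G-odd-tail-bb : ∀ m {t} → a ∷ t ≡ G (3 + double m) → (b ∷ b ∷ []) ≼ (t ++ [ b ])
G-odd-tail-bb m at≡G with subst (λ g → (a ∷ b ∷ b ∷ []) ≼ (g ++ [ b ])) (sym at≡G) (G-odd-b-abb m)
... | r , eq = r , ∷-injectiveʳ eq

G-odd-next⋢H : ∀ m → ¬ (G (3 + double m) ++ [ b ]) ⊑ H (2 + double m)
G-even-next⋢H : ∀ m → ¬ (G (4 + double m) ++ [ a ]) ⊑ H (3 + double m)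

G-odd-next⋢H zero occ with ⊑-length occ
... | s≤s (s≤s ())
G-odd-next⋢H (suc m) occ with ⊑-∷ (H-σ (3 + double m)) occ
... | inj₁ occ-prefix
  with ≼-ordered (≼-trans (G-odd-b-abb (suc m)) occ-prefix) (H-aba (suc (double m)))
                 (s≤s (s≤s (s≤s z≤n)))
...   | _ , ()
G-odd-next⋢H (suc m) occ | inj₂ occ-σ =
  G-even-next⋢H m (σ-reflects-⊑ (H (3 + double m)) (≼-++ [ a ] (G-even-head m))
                    (subst (_⊑ σ (H (3 + double m))) (sym σ-G-a) occ-σ))
  where
  σ-G-a : σ (G (4 + double m) ++ [ a ]) ≡ G (5 + double m) ++ [ b ]
  σ-G-a = trans (σ-++ (G (4 + double m)) [ a ]) (cong (_++ [ b ]) (σ-G (3 + double m)))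

G-even-next⋢H m occ with ⊑-∷ (H-σ (2 + double m)) occ
... | inj₁ occ-prefix
  with ≼-ordered (≼-trans (≼-++ [ a ] (G-even-head m)) occ-prefix)
                 (σ (H (2 + double m)) , sym (H-σ (2 + double m))) (s≤s z≤n)
...   | _ , ()
G-even-next⋢H m occ | inj₂ occ-σ with G-odd-head m
... | t , at≡G
  with σ-desubst-tail t (H (2 + double m))
         (subst (λ g → (g ++ [ a ]) ⊑ σ (H (2 + double m))) (G-even≡σ m at≡G) occ-σ)
...   | a , occ' = G-odd-next⋢H m (subst (λ g → (g ++ [ b ]) ⊑ H (2 + double m)) at≡G occ')
...   | b , occ' =
  bbb⋢H (double m) (⊑-trans (≼⇒⊑ (map₂ (cong (b ∷_)) (G-odd-tail-bb m at≡G))) occ')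

phrases : ℕ → ℕ → List Word
phrases s zero = [ [ b ] ]
phrases s (suc n) = G (suc s) ∷ phrases (suc s) n

H-++-concat-phrases : ∀ s n → H s ++ concat (phrases s n) ≡ H (s + n) ++ [ b ]
H-++-concat-phrases s zero = cong (λ k → H k ++ [ b ]) (sym (+-identityʳ s))
H-++-concat-phrases s (suc n) = begin
  H s ++ G (suc s) ++ concat (phrases (suc s) n)    ≡⟨ ++-assoc (H s) (G (suc s)) _ ⟨
  H (suc s) ++ concat (phrases (suc s) n)           ≡⟨ H-++-concat-phrases (suc s) n ⟩
  H (suc s + n) ++ [ b ]                            ≡⟨ cong (λ k → H k ++ [ b ]) (+-suc s n) ⟨
  H (s + suc n) ++ [ b ]                            ∎

applyUpTo-phrases : ∀ f s n → (∀ j → f j ≡ G (suc (s + j))) →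
                    applyUpTo f n ++ [ [ b ] ] ≡ phrases s n
applyUpTo-phrases f s zero _ = refl
applyUpTo-phrases f s (suc n) f≗G = cong₂ _∷_
  (trans (f≗G 0) (cong (G ∘ suc) (+-identityʳ s)))
  (applyUpTo-phrases (f ∘ suc) (suc s) n (λ j → trans (f≗G (suc j)) (cong (G ∘ suc) (+-suc s j))))

copy-G : ∀ {d rest ps} s → [ d ] ≼ rest → ¬ (G (3 + s) ++ [ d ]) ⊑ H (2 + s) →
         LZFrom (H (3 + s)) rest ps → LZFrom (H (2 + s)) (G (3 + s) ++ rest) (G (3 + s) ∷ ps)
copy-G s d≼rest fresh =
  lz-copy (G (3 + s)) (G-nonempty (2 + s)) (G-⊑-H s) (longest-factor-prefix d≼rest fresh)

copy-b : ∀ n → LZFrom (H (2 + n)) [ b ] [ [ b ] ]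
copy-b n = lz-copy [ b ] (s≤s z≤n) (b-⊑-H n) (λ t t≼b _ → ⊑-length (≼⇒⊑ t≼b)) lz-done

LZ-phrases-from : ∀ k n → LZFrom (H (2 + double k)) (concat (phrases (2 + double k) (suc (double n))))
                                 (phrases (2 + double k) (suc (double n)))
LZ-phrases-from k zero = copy-G (double k) ([] , refl) (G-odd-next⋢H k) (copy-b (suc (double k)))
LZ-phrases-from k (suc n) =
  copy-G (double k) (≼-++ _ (G-even-head k)) (G-odd-next⋢H k)
    (copy-G (suc (double k)) (≼-++ _ (G-odd-head (suc k))) (G-even-next⋢H k)
      (LZ-phrases-from (suc k) n))

b∉[a] : ¬ b ∈ [ a ]
b∉[a] (here ())

LZ-phrases : ∀ m → IsLZ (concat (phrases 0 (suc (double m)))) (phrases 0 (suc (double m)))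
LZ-phrases zero = lz-new a (λ ()) (lz-new b b∉[a] lz-done)
LZ-phrases (suc m) = lz-new a (λ ()) (lz-new b b∉[a] (LZ-phrases-from 0 m))

πab-σ : ∀ w → πab w ++ a ∷ b ∷ [] ≡ σ (b ∷ σ w)
πab-σ [] = refl
πab-σ (a ∷ w) = cong (λ v → a ∷ b ∷ v) (πab-σ w)
πab-σ (b ∷ w) = cong (λ v → a ∷ b ∷ b ∷ v) (πab-σ w)

P≡H : ∀ m → P (2 + m) ≡ H (suc (double m)) ++ [ b ]
P≡H zero = refl
P≡H (suc m) = begin
  πab (P (2 + m))                      ≡⟨ cong πab (P≡H m) ⟩
  πab (h ++ [ b ])                     ≡⟨ concatMap-++ πab-sym h [ b ] ⟩
  πab h ++ a ∷ b ∷ b ∷ []               ≡⟨ ++-assoc (πab h) (a ∷ b ∷ []) [ b ] ⟨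
  (πab h ++ a ∷ b ∷ []) ++ [ b ]        ≡⟨ cong (_++ [ b ]) (πab-σ h) ⟩
  σ (b ∷ σ h) ++ [ b ]                  ≡⟨ cong (_++ [ b ]) (H-σ² (suc (double m))) ⟨
  H (3 + double m) ++ [ b ]             ∎
  where
  h : Word
  h = H (suc (double m))

2*-∸3 : ∀ m → 2 * (2 + m) ∸ 3 ≡ suc (double m)
2*-∸3 m = cong (_∸ 3) (2*≡double (2 + m))
  where
  2*≡double : ∀ n → 2 * n ≡ double n
  2*≡double zero = refl
  2*≡double (suc n) = cong suc (trans (+-suc n (n + 0)) (cong suc (2*≡double n)))

lemma4 : (i : ℕ) → 2 ≤ i →
    IsLZ (P i) (map (λ j → reverse (F b a (suc j))) (upTo (2 * i ∸ 3)) ++ [ [ b ] ])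
    × (∀ ps → IsLZ (P i) ps →
         ps ≡ map (λ j → reverse (F b a (suc j))) (upTo (2 * i ∸ 3)) ++ [ [ b ] ])
lemma4 (suc (suc m)) (s≤s (s≤s z≤n)) = factorization , λ ps lz → LZFrom-unique lz factorization
  where
  paper-phrases : ℕ → List Word
  paper-phrases n = map (λ j → reverse (F b a (suc j))) (upTo n) ++ [ [ b ] ]

  phrases≡paper : phrases 0 (suc (double m)) ≡ paper-phrases (2 * (2 + m) ∸ 3)
  phrases≡paper = begin
    phrases 0 (suc (double m))
      ≡⟨ applyUpTo-phrases _ 0 (suc (double m)) (λ j → reverse-F≡G (suc j)) ⟨
    applyUpTo (λ j → reverse (F b a (suc j))) (suc (double m)) ++ [ [ b ] ]
      ≡⟨ cong (_++ [ [ b ] ]) (map-applyUpTo id (λ j → reverse (F b a (suc j))) (suc (double m))) ⟨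
    paper-phrases (suc (double m))
      ≡⟨ cong paper-phrases (2*-∸3 m) ⟨
    paper-phrases (2 * (2 + m) ∸ 3) ∎

  concat≡P : concat (phrases 0 (suc (double m))) ≡ P (2 + m)
  concat≡P = trans (H-++-concat-phrases 0 (suc (double m))) (sym (P≡H m))

  factorization : IsLZ (P (2 + m)) (paper-phrases (2 * (2 + m) ∸ 3))
  factorization = subst₂ IsLZ concat≡P phrases≡paper (LZ-phrases m)
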